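{- Let $\mathcal{C}$ be a class of finite graphs for which there is a natural number $N$ such that every set of disjoint edges in every member of $\mathcal{C}$ has size at most $N$. Then $\mathcal{C}$ is well quasi-ordered under both the standard and the strong homomorphic image orderings.
   Context: A graph is a digraph (set with binary edge relation) whose edge relation is symmetric and is either reflexive (loops at all vertices) or irreflexive (no loops); an undirected edge $\{x,y\}$ corresponds to the pairs $(x,y),(y,x)$. Edges $\{a_1,b_1\},\dots,\{a_k,b_k\}$ are disjoint if all the vertices $a_1,\dots,a_k,b_1,\dots,b_k$ are distinct. A homomorphism maps edges to edges; it is strong if moreover every edge of the target between vertices in the image is the image of some edge. Surjective (strong) homomorphisms are (strong) epimorphisms. Homomorphic image ordering: $A\preceq B$ iff there is an epimorphism $B\to A$; strong version: iff there is a strong epimorphism $B\to A$. Well quasi-ordered means: no infinite strictly decreasing sequence and no infinite antichain. -}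

module Defs where

open import Data.Nat using (ℕ; _≤_; _<_)
open import Data.Fin using (Fin)
open import Data.Bool using (Bool; true; false)
open import Data.Sum using (_⊎_; [_,_])
open import Data.Product using (Σ; ∃; _×_; _,_)
open import Relation.Binary.PropositionalEquality using (_≡_)
open import Relation.Nullary using (¬_)
open import Function.Definitions using (Injective)

record Graph : Set where
  field
    size  : ℕ
    E     : Fin size → Fin size → Bool
    sym   : ∀ x y → E x y ≡ E y x
    loops : (∀ x → E x x ≡ true) ⊎ (∀ x → E x x ≡ false)
open Graph public

Edge : (G : Graph) → Fin (size G) → Fin (size G) → Set
Edge G x y = E G x y ≡ true

-- A family of k disjoint edges {a i, b i}: all 2k endpoints distinct.
DisjointEdges : (G : Graph) (k : ℕ) → (Fin k → Fin (size G)) → (Fin k → Fin (size G)) → Set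
DisjointEdges G k a b =
  (∀ i → Edge G (a i) (b i)) × Injective _≡_ _≡_ [ a , b ]

MatchingBounded : ℕ → Graph → Set
MatchingBounded N G =
  ∀ k (a b : Fin k → Fin (size G)) → DisjointEdges G k a b → k ≤ N

IsHom : (G H : Graph) → (Fin (size G) → Fin (size H)) → Set
IsHom G H f = ∀ x y → Edge G x y → Edge H (f x) (f y)

Surjective : ∀ {m n} → (Fin m → Fin n) → Set
Surjective {m} f = ∀ y → Σ (Fin m) λ x → f x ≡ y

InImage : ∀ {m n} → (Fin m → Fin n) → Fin n → Set
InImage {m} f y = Σ (Fin m) λ x → f x ≡ y

IsStrong : (G H : Graph) → (Fin (size G) → Fin (size H)) → Set
IsStrong G H f = ∀ u v → InImage f u → InImage f v → Edge H u v →
  Σ (Fin (size G)) λ x → Σ (Fin (size G)) λ y → Edge G x y × (f x ≡ u) × (f y ≡ v)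

IsEpi : (G H : Graph) → (Fin (size G) → Fin (size H)) → Set
IsEpi G H f = IsHom G H f × Surjective f

IsStrongEpi : (G H : Graph) → (Fin (size G) → Fin (size H)) → Set
IsStrongEpi G H f = IsEpi G H f × IsStrong G H f

_≼_ : Graph → Graph → Set
A ≼ B = Σ (Fin (size B) → Fin (size A)) λ f → IsEpi B A f

_≼ₛ_ : Graph → Graph → Set
A ≼ₛ B = Σ (Fin (size B) → Fin (size A)) λ f → IsStrongEpi B A f

WellQuasiOrdered : {A : Set} → (A → Set) → (A → A → Set) → Set
WellQuasiOrdered {A} P _≤ₚ_ =
  ¬ (Σ (ℕ → A) λ s → (∀ i → P (s i)) ×
       (∀ i → (s (Data.Nat.suc i) ≤ₚ s i) × ¬ (s i ≤ₚ s (Data.Nat.suc i))))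
  × ¬ (Σ (ℕ → A) λ s → (∀ i → P (s i)) ×
       (∀ i j → i < j → ¬ (s i ≤ₚ s j) × ¬ (s j ≤ₚ s i)))

module Submission where

-- The endpoints of a maximal matching form a vertex cover; when matchings
-- have at most N edges it fits into N + N slots. Relative to such a cover,
-- every vertex has a class: the slot it occupies, or, outside the cover (an
-- independent set), its neighbourhood among the slots. Adjacency of distinct
-- vertices depends only on their classes, so a graph is described by finite
-- data: its loop type, the adjacency table of the classes, and the class
-- sizes. When this data agrees and every class of A is no larger than in B
-- (and nonempty when it is in B), any class-preserving surjection B → A is a
-- strong epimorphism. Comparing the finite data is an almost-full relation,
-- because almost-full relations (in the inductive sense of Vytiniotis,
-- Coquand and Wahlstedt) are closed under intersection and finite pointwise
-- conjunction; hence strong homomorphic images are almost full on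
-- matching-bounded graphs, and a transitive almost-full relation is a wqo.

open import Defs hiding (sym)
open import Axiom.UniquenessOfIdentityProofs using (module Decidable⇒UIP)
open import Data.Bool using (Bool; true; false)
open import Data.Bool.Properties using (¬-not) renaming (_≟_ to _≟ᵇ_)
open import Data.Empty using (⊥; ⊥-elim)
open import Data.Fin using (Fin; zero; suc; toℕ; fromℕ<; inject≤; splitAt; join)
open import Data.Fin.Properties
  using (any?; toℕ<n; toℕ-injective; toℕ-fromℕ<; toℕ-inject≤; splitAt-join) renaming (_≟_ to _≟ᶠ_)
open import Data.List using (List; []; _∷_; length; filter; allFin)
open import Data.List.Membership.Propositional using (_∈_)
open import Data.List.Membership.Propositional.Properties using (∈-filter⁺; ∈-filter⁻; ∈-allFin)
open import Data.List.Membership.Setoid.Properties using (unique⇒irrelevant)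
open import Data.List.Relation.Unary.All as All using (All)
open import Data.List.Relation.Unary.Any using (here; there; index)
open import Data.List.Relation.Unary.Unique.Propositional.Properties using (filter⁺; allFin⁺)
open import Data.Maybe using (Maybe; just; nothing)
import Data.Maybe as Maybe
import Data.Maybe.Properties as Maybeₚ
open import Data.Nat using (ℕ; zero; suc; _+_; _≤_; _<_; z≤n; s≤s; _≤?_; _<?_; _≡ᵇ_)
open import Data.Nat.Properties
  using (≰⇒>; m≤n⇒m<n∨m≡n; <-≤-trans; n≢0⇒n>0; +-suc; +-identityʳ; n<1+n; <⇒≱)
open import Data.Product using (Σ; _×_; _,_; proj₁; proj₂)
open import Data.Sum using (_⊎_; inj₁; inj₂; [_,_])
import Data.Sum as Sum
import Data.Sum.Properties as Sumₚ
open import Data.Vec using (Vec; []; _∷_; lookup; tabulate)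
import Data.Vec.Functional as Vector
import Data.Vec.Properties as Vecₚ
open import Function.Base using (_on_; _∘_; id; const)
open import Function.Definitions using (Injective)
open import Level using (0ℓ)
open import Relation.Binary.Core using (Rel; _⇒_)
open import Relation.Binary.Definitions using (Transitive; DecidableEquality)
open import Relation.Binary.PropositionalEquality
  using (_≡_; _≢_; refl; sym; trans; cong; cong₂; subst; setoid; module ≡-Reasoning)
open import Relation.Nullary using (¬_; Dec; yes; no; contradiction)
open import Relation.Nullary.Decidable using (_×-dec_; ¬?)

private
  variable
    X Y : Set

_↑_ : Rel X 0ℓ → X → Rel X 0ℓ
(R ↑ x) y z = R y z ⊎ R x y

-- Almost-full relations (Vytiniotis–Coquand–Wahlstedt): an inductive,
-- constructive formulation of "every infinite sequence has a good pair".
data AlmostFull {X : Set} : Rel X 0ℓ → Set₁ where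
  now   : ∀ {R} → (∀ x y → R x y) → AlmostFull R
  later : ∀ {R} → (∀ x → AlmostFull (R ↑ x)) → AlmostFull R

af-mono : ∀ {R S : Rel X 0ℓ} → R ⇒ S → AlmostFull R → AlmostFull S
af-mono R⇒S (now r)   = now (λ x y → R⇒S (r x y))
af-mono R⇒S (later k) = later (λ x → af-mono (Sum.map R⇒S R⇒S) (k x))

af-comap : ∀ {R : Rel X 0ℓ} (f : Y → X) → AlmostFull R → AlmostFull (R on f)
af-comap f (now r)   = now (λ x y → r (f x) (f y))
af-comap f (later k) = later (λ x → af-comap f (k (f x)))

af-good : ∀ {R : Rel X 0ℓ} → AlmostFull R → (s : ℕ → X) →
          Σ ℕ λ i → Σ ℕ λ j → i < j × R (s i) (s j)
af-good (now r) s = 0 , 1 , s≤s z≤n , r (s 0) (s 1)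
af-good (later k) s with af-good (k (s 0)) (λ n → s (suc n))
... | i , j , i<j , inj₁ r = suc i , suc j , s≤s i<j , r
... | i , j , i<j , inj₂ r = 0 , suc i , s≤s z≤n , r

-- ≤ on ℕ is almost full; after seeing n, every y ≥ n is already good.
af-≤-above : ∀ n → AlmostFull (λ y z → y ≤ z ⊎ n ≤ y)
af-≤-above zero    = now (λ _ _ → inj₂ z≤n)
af-≤-above (suc n) = later (λ x → af-mono (step x) (af-≤-above n))
  where
  step : ∀ x {y z} → y ≤ z ⊎ n ≤ y → (y ≤ z ⊎ suc n ≤ y) ⊎ (x ≤ y ⊎ suc n ≤ x)
  step x (inj₁ y≤z) = inj₁ (inj₁ y≤z)
  step x (inj₂ n≤y) with m≤n⇒m<n∨m≡n n≤y
  ... | inj₁ n<y = inj₁ (inj₂ n<y)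
  ... | inj₂ refl with x ≤? n
  ...   | yes x≤n = inj₂ (inj₁ x≤n)
  ...   | no  x≰n = inj₂ (inj₂ (≰⇒> x≰n))

af-≤ : AlmostFull _≤_
af-≤ = later af-≤-above

-- Equality on Bool is almost full: among three booleans two coincide.
af-≡-Bool : AlmostFull {Bool} _≡_
af-≡-Bool = later (λ x → later (λ y → now (λ a _ → pigeonhole x y a)))
  where
  pigeonhole : ∀ x y a {b} → ((a ≡ b ⊎ x ≡ a) ⊎ (y ≡ a ⊎ x ≡ y))
  pigeonhole false false _     = inj₂ (inj₂ refl)
  pigeonhole true  true  _     = inj₂ (inj₂ refl)
  pigeonhole false true  false = inj₁ (inj₂ refl)
  pigeonhole false true  true  = inj₂ (inj₁ refl)
  pigeonhole true  false false = inj₂ (inj₁ refl)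
  pigeonhole true  false true  = inj₁ (inj₂ refl)

-- Following Vytiniotis–Coquand–Wahlstedt, one proves successively more general
-- statements "R ∪ A and R ∪ B almost full ⇒ R ∪ (A ∩ B) almost full" for side
-- conditions A, B that are nullary, unary and binary. Each is stated for any
-- Q ⊆ R ∪ A and S ⊆ R ∪ B, so that the induction hypothesis applies to the
-- relations produced by `later`.

private
  ∪-× : {R A B : Set} → R ⊎ A → R ⊎ B → R ⊎ (A × B)
  ∪-× (inj₁ r) _        = inj₁ r
  ∪-× (inj₂ _) (inj₁ r) = inj₁ r
  ∪-× (inj₂ a) (inj₂ b) = inj₂ (a , b)

  -- unfolding (R ∪ C) ↑ x from (R ↑ x) ∪ C(y,z) ∪ C(x,y)
  regroup : {a b c d : Set} → ((a ⊎ b) ⊎ c) ⊎ d → (a ⊎ c) ⊎ (b ⊎ d)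
  regroup (inj₁ (inj₁ (inj₁ a))) = inj₁ (inj₁ a)
  regroup (inj₁ (inj₁ (inj₂ b))) = inj₂ (inj₁ b)
  regroup (inj₁ (inj₂ c))        = inj₁ (inj₂ c)
  regroup (inj₂ d)               = inj₂ (inj₂ d)

  -- separating the part of a side condition contributed by the seen element
  split-left : {r a a' b : Set} → r ⊎ ((a ⊎ a') × b) → (r ⊎ (a × b)) ⊎ a'
  split-left (inj₁ r)            = inj₁ (inj₁ r)
  split-left (inj₂ (inj₁ a , b)) = inj₁ (inj₂ (a , b))
  split-left (inj₂ (inj₂ a , _)) = inj₂ a

  split-right : {r a b b' : Set} → r ⊎ (a × (b ⊎ b')) → (r ⊎ (a × b)) ⊎ b'
  split-right (inj₁ r)            = inj₁ (inj₁ r)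
  split-right (inj₂ (a , inj₁ b)) = inj₁ (inj₂ (a , b))
  split-right (inj₂ (_ , inj₂ b)) = inj₂ b

  ↑-side : {R Q : Rel X 0ℓ} {C : X → X → Set} {C' : X → X → Set} (x : X) →
           (∀ {y z} → Q y z → R y z ⊎ C y z) →
           (∀ {y z} → C y z → C' y z) → (∀ {y z} → C x y → C' y z) →
           ∀ {y z} → (Q ↑ x) y z → (R ↑ x) y z ⊎ C' y z
  ↑-side x hQ f g (inj₁ q) = Sum.map inj₁ f (hQ q)
  ↑-side x hQ f g (inj₂ q) = Sum.map inj₂ g (hQ q)

∪-nullary : ∀ {Q S R : Rel X 0ℓ} {A B : Set} → AlmostFull Q → AlmostFull S →
            (∀ {y z} → Q y z → R y z ⊎ A) → (∀ {y z} → S y z → R y z ⊎ B) →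
            AlmostFull (λ y z → R y z ⊎ (A × B))
∪-nullary (now q) afS hQ hS = af-mono (λ s → ∪-× (hQ (q _ _)) (hS s)) afS
∪-nullary {Q = Q} {R = R} {A = A} (later kq) afS hQ hS = later λ x →
  af-mono (regroup ∘ inj₁)
    (∪-nullary {R = R ↑ x} (kq x) afS
      (↑-side {R = R} {Q} {λ _ _ → A} x hQ id id) (λ s → Sum.map₁ inj₁ (hS s)))

∪-unary : ∀ {Q S R : Rel X 0ℓ} {A B : X → Set} → AlmostFull Q → AlmostFull S →
          (∀ {y z} → Q y z → R y z ⊎ A y) → (∀ {y z} → S y z → R y z ⊎ B y) →
          AlmostFull (λ y z → R y z ⊎ (A y × B y))
∪-unary (now q) afS hQ hS = af-mono (λ s → ∪-× (hQ (q _ _)) (hS s)) afS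
∪-unary (later kq) (now s) hQ hS = af-mono (λ q → ∪-× (hQ q) (hS (s _ _))) (later kq)
∪-unary {Q = Q} {S} {R} {A} {B} (later kq) (later ks) hQ hS = later λ x →
  af-mono regroup
    (∪-nullary
      (∪-unary {R = R ↑ x} {λ y → A y ⊎ A x} {B} (kq x) (later ks)
        (↑-side {R = R} {Q} {λ y _ → A y} x hQ inj₁ inj₂) (λ s → Sum.map₁ inj₁ (hS s)))
      (∪-unary {R = R ↑ x} {A} {λ y → B y ⊎ B x} (later kq) (ks x)
        (λ q → Sum.map₁ inj₁ (hQ q)) (↑-side {R = R} {S} {λ y _ → B y} x hS inj₁ inj₂))
      split-left split-right)

∪-binary : ∀ {Q S R A B : Rel X 0ℓ} → AlmostFull Q → AlmostFull S →
           (∀ {y z} → Q y z → R y z ⊎ A y z) → (∀ {y z} → S y z → R y z ⊎ B y z) →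
           AlmostFull (λ y z → R y z ⊎ (A y z × B y z))
∪-binary (now q) afS hQ hS = af-mono (λ s → ∪-× (hQ (q _ _)) (hS s)) afS
∪-binary (later kq) (now s) hQ hS = af-mono (λ q → ∪-× (hQ q) (hS (s _ _))) (later kq)
∪-binary {Q = Q} {S} {R} {A} {B} (later kq) (later ks) hQ hS = later λ x →
  af-mono regroup
    (∪-unary
      (∪-binary {R = R ↑ x} {λ y z → A y z ⊎ A x y} {B} (kq x) (later ks)
        (↑-side {R = R} {Q} {A} x hQ inj₁ inj₂) (λ s → Sum.map₁ inj₁ (hS s)))
      (∪-binary {R = R ↑ x} {A} {λ y z → B y z ⊎ B x y} (later kq) (ks x)
        (λ q → Sum.map₁ inj₁ (hQ q)) (↑-side {R = R} {S} {B} x hS inj₁ inj₂))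
      split-left split-right)

af-∩ : ∀ {R S : Rel X 0ℓ} → AlmostFull R → AlmostFull S → AlmostFull (λ x y → R x y × S x y)
af-∩ afR afS = af-mono (λ { (inj₁ ()) ; (inj₂ rs) → rs })
  (∪-binary {R = λ _ _ → ⊥} afR afS inj₂ inj₂)

Finitary : Set → Set₁
Finitary I = ∀ {Y : Set} (R : I → Rel Y 0ℓ) → (∀ i → AlmostFull (R i)) →
             AlmostFull (λ y z → ∀ i → R i y z)

finitary-Fin : ∀ k → Finitary (Fin k)
finitary-Fin zero    R afR = now (λ _ _ ())
finitary-Fin (suc k) R afR =
  af-mono (λ { (r , rs) zero → r ; (r , rs) (suc i) → rs i })
          (af-∩ (afR zero) (finitary-Fin k (R ∘ suc) (afR ∘ suc)))

finitary-Bool : Finitary Bool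
finitary-Bool R afR =
  af-mono (λ { (r , _) true → r ; (_ , r) false → r }) (af-∩ (afR true) (afR false))

finitary-⊎ : ∀ {I J} → Finitary I → Finitary J → Finitary (I ⊎ J)
finitary-⊎ finI finJ R afR =
  af-mono (λ { (r , _) (inj₁ i) → r i ; (_ , r) (inj₂ j) → r j })
          (af-∩ (finI (R ∘ inj₁) (afR ∘ inj₁)) (finJ (R ∘ inj₂) (afR ∘ inj₂)))

finitary-Vec : ∀ {I} → Finitary I → ∀ k → Finitary (Vec I k)
finitary-Vec finI zero    R afR = af-mono (λ { r [] → r }) (afR [])
finitary-Vec finI (suc k) R afR =
  af-mono (λ { r (i ∷ is) → r i is })
          (finI (λ i y z → ∀ is → R (i ∷ is) y z)
                (λ i → finitary-Vec finI k (R ∘ (i ∷_)) (afR ∘ (i ∷_))))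

-- m ⊑ n : m ≤ n, and m vanishes only if n does. This is the comparison of
-- class sizes that allows a class-preserving surjection.
_⊑_ : Rel ℕ 0ℓ
m ⊑ n = m ≤ n × (m ≡ 0 → n ≡ 0)

af-⊑ : AlmostFull _⊑_
af-⊑ = af-mono (λ (m≤n , same) → m≤n , vanishing same)
               (af-∩ af-≤ (af-comap (_≡ᵇ 0) af-≡-Bool))
  where
  vanishing : ∀ {m n} → (m ≡ᵇ 0) ≡ (n ≡ᵇ 0) → m ≡ 0 → n ≡ 0
  vanishing {zero} {zero} _ _ = refl
  vanishing {zero} {suc _} () _

-- A transitive relation that is almost full on the elements satisfying P is
-- a well quasi-order on P: a good pair rules out infinite antichains, and,
-- by transitivity, also infinite strictly descending sequences.
module _ {A : Set} {_≤_ : A → A → Set} (transitive : Transitive _≤_) where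

  descend : (s : ℕ → A) → (∀ k → s (suc k) ≤ s k) →
            ∀ {i j} → i < j → s i ≤ s j → s i ≤ s (suc i)
  descend s step {i} {suc j} (s≤s i≤j) sᵢ≤sⱼ with m≤n⇒m<n∨m≡n i≤j
  ... | inj₂ refl = sᵢ≤sⱼ
  ... | inj₁ i<j  = descend s step i<j (transitive {s i} {s (suc j)} {s j} sᵢ≤sⱼ (step j))

  almostFull⇒wqo : ∀ {P : A → Set} → AlmostFull {Σ A P} (λ x y → proj₁ x ≤ proj₁ y) →
                   WellQuasiOrdered P _≤_
  almostFull⇒wqo {P} af = no-descending , no-antichain
    where
    good : (s : ℕ → A) → (∀ i → P (s i)) → Σ ℕ λ i → Σ ℕ λ j → i < j × s i ≤ s j
    good s Ps = af-good af (λ i → s i , Ps i)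

    no-descending : ¬ (Σ (ℕ → A) λ s → (∀ i → P (s i)) ×
                         (∀ i → (s (suc i) ≤ s i) × ¬ (s i ≤ s (suc i))))
    no-descending (s , Ps , desc) with good s Ps
    ... | i , j , i<j , sᵢ≤sⱼ = proj₂ (desc i) (descend s (proj₁ ∘ desc) i<j sᵢ≤sⱼ)

    no-antichain : ¬ (Σ (ℕ → A) λ s → (∀ i → P (s i)) ×
                        (∀ i j → i < j → ¬ (s i ≤ s j) × ¬ (s j ≤ s i)))
    no-antichain (s , Ps , antichain) with good s Ps
    ... | i , j , i<j , sᵢ≤sⱼ = proj₁ (antichain i j i<j) sᵢ≤sⱼ

epi-∘ : ∀ {A B C g f} → IsEpi B A g → IsEpi C B f → IsEpi C A (g ∘ f)
epi-∘ {g = g} (g-hom , g-surj) (f-hom , f-surj) =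
  (λ x y e → g-hom _ _ (f-hom x y e)) ,
  (λ a → let (b , gb≡a) = g-surj a ; (c , fc≡b) = f-surj b in c , trans (cong g fc≡b) gb≡a)

strong-∘ : ∀ {A B C g f} → IsStrongEpi B A g → IsStrongEpi C B f → IsStrong C A (g ∘ f)
strong-∘ {g = g} ((_ , g-surj) , g-strong) ((_ , f-surj) , f-strong) u v _ _ euv
  with g-strong u v (g-surj u) (g-surj v) euv
... | x , y , exy , gx≡u , gy≡v with f-strong x y (f-surj x) (f-surj y) exy
...   | x' , y' , ex'y' , fx'≡x , fy'≡y =
  x' , y' , ex'y' , trans (cong g fx'≡x) gx≡u , trans (cong g fy'≡y) gy≡v

≼-trans : Transitive _≼_
≼-trans {A} {B} {C} (g , g-epi) (f , f-epi) = g ∘ f , epi-∘ {A} {B} {C} g-epi f-epi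

≼ₛ-trans : Transitive _≼ₛ_
≼ₛ-trans {A} {B} {C} (g , g-sepi@(g-epi , _)) (f , f-sepi@(f-epi , _)) =
  g ∘ f , epi-∘ {A} {B} {C} g-epi f-epi , strong-∘ {A} {B} {C} g-sepi f-sepi

≼ₛ⇒≼ : ∀ {A B} → A ≼ₛ B → A ≼ B
≼ₛ⇒≼ (f , epi , _) = f , epi

loopBit : Graph → Bool
loopBit G = [ const true , const false ] (loops G)

loop-edge : ∀ G u → E G u u ≡ loopBit G
loop-edge G u with loops G
... | inj₁ reflexive   = reflexive u
... | inj₂ irreflexive = irreflexive u

record Presentation (Cl : Set) (G : Graph) : Set where
  field
    class             : Fin (size G) → Cl
    adjacency         : Cl → Cl → Bool
    edge-class        : ∀ {u v} → u ≢ v → E G u v ≡ adjacency (class u) (class v)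
    class-independent : ∀ {u v} → u ≢ v → class u ≡ class v → E G u v ≡ false

class-preserving⇒strongEpi :
  ∀ {Cl A B} (pA : Presentation Cl A) (pB : Presentation Cl B) →
  loopBit A ≡ loopBit B →
  (∀ a b → Presentation.adjacency pA a b ≡ Presentation.adjacency pB a b) →
  (f : Fin (size B) → Fin (size A)) →
  (∀ v → Presentation.class pA (f v) ≡ Presentation.class pB v) →
  Surjective f → IsStrongEpi B A f
class-preserving⇒strongEpi {A = A} {B} pA pB loops≡ adjacency≡ f f-class f-surj =
  (hom , f-surj) , strong
  where
  module PA = Presentation pA
  module PB = Presentation pB
  open ≡-Reasoning

  loop-transfer : ∀ x → E A (f x) (f x) ≡ E B x x
  loop-transfer x = trans (loop-edge A (f x)) (trans loops≡ (sym (loop-edge B x)))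

  edge-transfer : ∀ {x y} → f x ≢ f y → E A (f x) (f y) ≡ E B x y
  edge-transfer {x} {y} fx≢fy = begin
    E A (f x) (f y)                                 ≡⟨ PA.edge-class fx≢fy ⟩
    PA.adjacency (PA.class (f x)) (PA.class (f y))  ≡⟨ cong₂ PA.adjacency (f-class x) (f-class y) ⟩
    PA.adjacency (PB.class x) (PB.class y)          ≡⟨ adjacency≡ _ _ ⟩
    PB.adjacency (PB.class x) (PB.class y)          ≡⟨ sym (PB.edge-class (fx≢fy ∘ cong f)) ⟩
    E B x y                                         ∎

  hom : IsHom B A f
  hom x y exy with f x ≟ᶠ f y | x ≟ᶠ y
  ... | no fx≢fy  | _        = trans (edge-transfer fx≢fy) exy
  ... | yes _     | yes refl = trans (loop-transfer x) exy
  ... | yes fx≡fy | no x≢y   =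
    contradiction (trans (sym exy) (PB.class-independent x≢y same-class)) λ ()
    where
    same-class : PB.class x ≡ PB.class y
    same-class = trans (sym (f-class x)) (trans (cong PA.class fx≡fy) (f-class y))

  strong : IsStrong B A f
  strong _ _ (x , refl) (y , refl) e with f x ≟ᶠ f y
  ... | no fx≢fy  = x , y , trans (sym (edge-transfer fx≢fy)) e , refl , refl
  ... | yes fx≡fy =
    x , x , trans (sym (loop-transfer x)) (subst (Edge A (f x)) (sym fx≡fy) e) , refl , fx≡fy

lookupOr : X → List X → ℕ → X
lookupOr d []       _       = d
lookupOr d (x ∷ xs) zero    = x
lookupOr d (x ∷ xs) (suc k) = lookupOr d xs k

lookupOr-index : ∀ {d x} {xs : List X} (p : x ∈ xs) → lookupOr d xs (toℕ (index p)) ≡ x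
lookupOr-index (here refl) = refl
lookupOr-index (there p)   = lookupOr-index p

lookupOr-All : ∀ {P : X → Set} {d} {xs} k → P d → All P xs → P (lookupOr d xs k)
lookupOr-All _       Pd All.[]         = Pd
lookupOr-All zero    Pd (Px All.∷ _)   = Px
lookupOr-All (suc k) Pd (_ All.∷ Pxs)  = lookupOr-All k Pd Pxs

member-at : ∀ (xs : List X) k → k < length xs → Σ X λ x → Σ (x ∈ xs) λ p → toℕ (index p) ≡ k
member-at (x ∷ xs) zero    _         = x , here refl , refl
member-at (x ∷ xs) (suc k) (s≤s k<n) with member-at xs k k<n
... | y , p , p-at-k = y , there p , cong suc p-at-k

∈⇒length≢0 : ∀ {x} {xs : List X} → x ∈ xs → length xs ≢ 0
∈⇒length≢0 (here _)  ()
∈⇒length≢0 (there _) ()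

module Fibres {Cl : Set} (_≟_ : DecidableEquality Cl) where

  fibre : ∀ {n} → (Fin n → Cl) → Cl → List (Fin n)
  fibre {n} κ cl = filter (λ u → κ u ≟ cl) (allFin n)

  count : ∀ {n} → (Fin n → Cl) → Cl → ℕ
  count κ cl = length (fibre κ cl)

  ∈-fibre : ∀ {n} (κ : Fin n → Cl) u → u ∈ fibre κ (κ u)
  ∈-fibre κ u = ∈-filter⁺ (λ w → κ w ≟ κ u) (∈-allFin u) refl

  fibre-class : ∀ {n} {κ : Fin n → Cl} {u cl} → u ∈ fibre κ cl → κ u ≡ cl
  fibre-class {n} {κ} {cl = cl} p = proj₂ (∈-filter⁻ (λ w → κ w ≟ cl) {xs = allFin n} p)

  -- a fibre has no repetitions, so a vertex occurs in it at a single position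
  fibre-irrelevant : ∀ {n} {κ : Fin n → Cl} {u cl} (p q : u ∈ fibre κ cl) → p ≡ q
  fibre-irrelevant {n} {κ} {cl = cl} =
    unique⇒irrelevant (setoid (Fin n)) (Decidable⇒UIP.≡-irrelevant _≟ᶠ_)
                      (filter⁺ (λ w → κ w ≟ cl) (allFin⁺ n))

  rank : ∀ {n} → (Fin n → Cl) → Fin n → ℕ
  rank κ u = toℕ (index (∈-fibre κ u))

  rank-unique : ∀ {n} {κ : Fin n → Cl} {u cl} (p : u ∈ fibre κ cl) → rank κ u ≡ toℕ (index p)
  rank-unique {κ = κ} {u} p = same-position (fibre-class p) (∈-fibre κ u)
    where
    same-position : ∀ {c} → c ≡ _ → (q : u ∈ fibre κ c) → toℕ (index q) ≡ toℕ (index p)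
    same-position refl q = cong (λ r → toℕ (index r)) (fibre-irrelevant q p)

  -- If every class is at most as large in A as in B, and empty in A only when
  -- empty in B, then some class-preserving map from B onto A exists: send the
  -- vertex at position k of a fibre of B to the vertex at position k of the
  -- corresponding fibre of A (or to a fixed one past its end).
  class-surjection : ∀ {m n} (κA : Fin m → Cl) (κB : Fin n → Cl) →
    (∀ cl → count κA cl ⊑ count κB cl) →
    Σ (Fin n → Fin m) λ f → (∀ v → κA (f v) ≡ κB v) × Surjective f
  class-surjection {m} {n} κA κB counts⊑ = f , f-class , f-surj
    where
    nonempty : ∀ v → count κA (κB v) ≢ 0
    nonempty v empty = ∈⇒length≢0 (∈-fibre κB v) (proj₂ (counts⊑ (κB v)) empty)

    representative : ∀ v → Σ (Fin m) λ w → κA w ≡ κB v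
    representative v with member-at (fibre κA (κB v)) 0 (n≢0⇒n>0 (nonempty v))
    ... | w , p , _ = w , fibre-class p

    f : Fin n → Fin m
    f v = lookupOr (proj₁ (representative v)) (fibre κA (κB v)) (rank κB v)

    f-class : ∀ v → κA (f v) ≡ κB v
    f-class v = lookupOr-All {P = λ w → κA w ≡ κB v} (rank κB v) (proj₂ (representative v))
                             (All.tabulate (fibre-class {κ = κA}))

    -- w is hit by the vertex of B at the position of w in its fibre
    f-surj : Surjective f
    f-surj w = hit (member-at (fibre κB (κA w)) k (<-≤-trans (toℕ<n (index p)) (proj₁ (counts⊑ (κA w)))))
      where
      p : w ∈ fibre κA (κA w)
      p = ∈-fibre κA w
      k : ℕ
      k = toℕ (index p)
      hit : (Σ (Fin n) λ v → Σ (v ∈ fibre κB (κA w)) λ q → toℕ (index q) ≡ k) →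
            Σ (Fin n) λ v → f v ≡ w
      hit (v , q , q-at) = v , (begin
        f v                                ≡⟨ cong (lookupOr d (fibre κA (κB v))) (trans (rank-unique q) q-at) ⟩
        lookupOr d (fibre κA (κB v)) k     ≡⟨ cong (λ c → lookupOr d (fibre κA c) k) (fibre-class q) ⟩
        lookupOr d (fibre κA (κA w)) k     ≡⟨ lookupOr-index p ⟩
        w                                  ∎)
        where
        open ≡-Reasoning
        d : Fin m
        d = proj₁ (representative v)

_∈ˢ_ : ∀ {K} {V : Set} → V → (Fin K → Maybe V) → Set
u ∈ˢ slot = Σ (Fin _) λ i → slot i ≡ just u

_∈ˢ?_ : ∀ {K n} (u : Fin n) (slot : Fin K → Maybe (Fin n)) → Dec (u ∈ˢ slot)
u ∈ˢ? slot = any? (λ i → Maybeₚ.≡-dec _≟ᶠ_ (slot i) (just u))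

record Cover (K : ℕ) (G : Graph) : Set where
  field
    slot   : Fin K → Maybe (Fin (size G))
    covers : ∀ {u v} → u ≢ v → Edge G u v → u ∈ˢ slot ⊎ v ∈ˢ slot

extend-injective : ∀ {n k} {a b : Fin k → Fin n} {u v} →
  Injective _≡_ _≡_ [ a , b ] → u ≢ v →
  (∀ x → [ a , b ] x ≢ u) → (∀ x → [ a , b ] x ≢ v) →
  Injective _≡_ _≡_ [ u Vector.∷ a , v Vector.∷ b ]
extend-injective _ _   _      _      {inj₁ zero}    {inj₁ zero}    _ = refl
extend-injective _ _   _      _      {inj₂ zero}    {inj₂ zero}    _ = refl
extend-injective _ u≢v _      _      {inj₁ zero}    {inj₂ zero}    e = ⊥-elim (u≢v e)
extend-injective _ u≢v _      _      {inj₂ zero}    {inj₁ zero}    e = ⊥-elim (u≢v (sym e))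
extend-injective _ _   fresh₁ _      {inj₁ zero}    {inj₁ (suc j)} e = ⊥-elim (fresh₁ (inj₁ j) (sym e))
extend-injective _ _   fresh₁ _      {inj₁ zero}    {inj₂ (suc j)} e = ⊥-elim (fresh₁ (inj₂ j) (sym e))
extend-injective _ _   _      fresh₂ {inj₂ zero}    {inj₁ (suc j)} e = ⊥-elim (fresh₂ (inj₁ j) (sym e))
extend-injective _ _   _      fresh₂ {inj₂ zero}    {inj₂ (suc j)} e = ⊥-elim (fresh₂ (inj₂ j) (sym e))
extend-injective _ _   fresh₁ _      {inj₁ (suc i)} {inj₁ zero}    e = ⊥-elim (fresh₁ (inj₁ i) e)
extend-injective _ _   fresh₁ _      {inj₂ (suc i)} {inj₁ zero}    e = ⊥-elim (fresh₁ (inj₂ i) e)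
extend-injective _ _   _      fresh₂ {inj₁ (suc i)} {inj₂ zero}    e = ⊥-elim (fresh₂ (inj₁ i) e)
extend-injective _ _   _      fresh₂ {inj₂ (suc i)} {inj₂ zero}    e = ⊥-elim (fresh₂ (inj₂ i) e)
extend-injective inj _ _      _      {inj₁ (suc i)} {inj₁ (suc j)} e = cong (Sum.map suc suc) (inj {inj₁ i} {inj₁ j} e)
extend-injective inj _ _      _      {inj₁ (suc i)} {inj₂ (suc j)} e = cong (Sum.map suc suc) (inj {inj₁ i} {inj₂ j} e)
extend-injective inj _ _      _      {inj₂ (suc i)} {inj₁ (suc j)} e = cong (Sum.map suc suc) (inj {inj₂ i} {inj₁ j} e)
extend-injective inj _ _      _      {inj₂ (suc i)} {inj₂ (suc j)} e = cong (Sum.map suc suc) (inj {inj₂ i} {inj₂ j} e)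

restrict : ∀ {N} k → Fin N → Maybe (Fin k)
restrict k i with toℕ i <? k
... | yes i<k = just (fromℕ< i<k)
... | no  _   = nothing

restrict-inject≤ : ∀ {N k} (i : Fin k) (k≤N : k ≤ N) → restrict k (inject≤ i k≤N) ≡ just i
restrict-inject≤ {k = k} i k≤N with toℕ (inject≤ i k≤N) <? k
... | yes lt = cong just (toℕ-injective (trans (toℕ-fromℕ< lt) (toℕ-inject≤ i k≤N)))
... | no ¬lt = ⊥-elim (¬lt (subst (_< k) (sym (toℕ-inject≤ i k≤N)) (toℕ<n i)))

-- The 2k endpoints of k ≤ N edges, placed in N + N slots.
endpointSlots : ∀ {N k} {V : Set} → (Fin k ⊎ Fin k → V) → Fin (N + N) → Maybe V
endpointSlots {N} {k} ends j =
  [ Maybe.map (ends ∘ inj₁) ∘ restrict k , Maybe.map (ends ∘ inj₂) ∘ restrict k ] (splitAt N j)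

endpoint∈slots : ∀ {N k} {V : Set} (ends : Fin k ⊎ Fin k → V) → k ≤ N →
                 ∀ x → ends x ∈ˢ endpointSlots {N} ends
endpoint∈slots {N} ends k≤N (inj₁ i) = join N N (inj₁ (inject≤ i k≤N)) ,
  trans (cong [ _ , _ ] (splitAt-join N N (inj₁ _))) (cong (Maybe.map _) (restrict-inject≤ i k≤N))
endpoint∈slots {N} ends k≤N (inj₂ i) = join N N (inj₂ (inject≤ i k≤N)) ,
  trans (cong [ _ , _ ] (splitAt-join N N (inj₂ _))) (cong (Maybe.map _) (restrict-inject≤ i k≤N))

-- Greedy maximal matching: if every matching of G has at most N edges, the
-- endpoints of a maximal matching form a vertex cover with N + N slots.
module _ {N : ℕ} (G : Graph) (bounded : MatchingBounded N G) where

  private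
    V : Set
    V = Fin (size G)

    FreeEdge : (Fin (N + N) → Maybe V) → Set
    FreeEdge slot = Σ V λ u → Σ V λ v → Edge G u v × u ≢ v × ¬ u ∈ˢ slot × ¬ v ∈ˢ slot

    freeEdge? : ∀ slot → Dec (FreeEdge slot)
    freeEdge? slot = any? λ u → any? λ v →
      (E G u v ≟ᵇ true) ×-dec ¬? (u ≟ᶠ v) ×-dec ¬? (u ∈ˢ? slot) ×-dec ¬? (v ∈ˢ? slot)

    maximal⇒cover : ∀ slot → ¬ FreeEdge slot → Cover (N + N) G
    maximal⇒cover slot none = record { slot = slot ; covers = covers }
      where
      covers : ∀ {u v} → u ≢ v → Edge G u v → u ∈ˢ slot ⊎ v ∈ˢ slot
      covers {u} {v} u≢v e with u ∈ˢ? slot | v ∈ˢ? slot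
      ... | yes u∈ | _      = inj₁ u∈
      ... | no _   | yes v∈ = inj₂ v∈
      ... | no u∉  | no v∉  = ⊥-elim (none (u , v , e , u≢v , u∉ , v∉))

    -- extend the matching while a free edge exists; the size bound N
    -- guarantees that fuel for N + 1 steps suffices
    grow : ∀ fuel {k} (a b : Fin k → V) → DisjointEdges G k a b → N < k + fuel → Cover (N + N) G
    grow zero {k} a b disjoint N<k+0 rewrite +-identityʳ k =
      ⊥-elim (<⇒≱ N<k+0 (bounded k a b disjoint))
    grow (suc fuel) {k} a b disjoint@(edges , inj) N<k+fuel
      with freeEdge? (endpointSlots {N} [ a , b ])
    ... | no none = maximal⇒cover _ none
    ... | yes (u , v , e , u≢v , u∉ , v∉) =
      grow fuel (u Vector.∷ a) (v Vector.∷ b)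
           (edges′ , extend-injective inj u≢v (untouched u∉) (untouched v∉))
           (subst (N <_) (+-suc k fuel) N<k+fuel)
      where
      edges′ : ∀ i → Edge G ((u Vector.∷ a) i) ((v Vector.∷ b) i)
      edges′ zero    = e
      edges′ (suc i) = edges i
      untouched : ∀ {w} → ¬ w ∈ˢ endpointSlots {N} [ a , b ] → ∀ x → [ a , b ] x ≢ w
      untouched w∉ x refl = w∉ (endpoint∈slots [ a , b ] (bounded k a b disjoint) x)

  matchingBounded⇒cover : Cover (N + N) G
  matchingBounded⇒cover = grow (suc N) Vector.[] Vector.[] ((λ ()) , λ { {inj₁ ()} ; {inj₂ ()} }) (n<1+n N)

-- Vertex classes relative to K cover slots: the vertex in slot i, or a vertex
-- outside the cover with the given neighbourhood among the slots.
Class : ℕ → Set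
Class K = Fin K ⊎ Vec Bool K

_≟ᶜ_ : ∀ {K} → DecidableEquality (Class K)
_≟ᶜ_ = Sumₚ.≡-dec _≟ᶠ_ (Vecₚ.≡-dec _≟ᵇ_)

-- A cover presents its graph over Class K: the vertices outside the cover
-- form an independent set, so each of them is determined, up to adjacency,
-- by its neighbourhood among the slots.
module _ {K} {G : Graph} (cover : Cover K G) where
  open Cover cover

  private
    V : Set
    V = Fin (size G)

    edgeTo : V → Maybe V → Bool
    edgeTo u (just w) = E G u w
    edgeTo u nothing  = false

    slotEdge : Maybe V → Maybe V → Bool
    slotEdge (just u) w = edgeTo u w
    slotEdge nothing  _ = false

  neighbourhood : V → Vec Bool K
  neighbourhood u = tabulate (λ j → edgeTo u (slot j))

  classAdjacency : Class K → Class K → Bool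
  classAdjacency (inj₁ i) (inj₁ j) = slotEdge (slot i) (slot j)
  classAdjacency (inj₁ i) (inj₂ T) = lookup T i
  classAdjacency (inj₂ S) (inj₁ j) = lookup S j
  classAdjacency (inj₂ _) (inj₂ _) = false

  data ClassOf (u : V) : Class K → Set where
    slotted : ∀ {i} → slot i ≡ just u → ClassOf u (inj₁ i)
    outside : ∀ {S} → ¬ u ∈ˢ slot → S ≡ neighbourhood u → ClassOf u (inj₂ S)

  classify : ∀ u → Σ (Class K) (ClassOf u)
  classify u with u ∈ˢ? slot
  ... | yes (i , slot-i) = inj₁ i , slotted slot-i
  ... | no  u∉          = inj₂ (neighbourhood u) , outside u∉ refl

  edge-class : ∀ {u v a b} → ClassOf u a → ClassOf v b → u ≢ v → E G u v ≡ classAdjacency a b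
  edge-class (slotted eu) (slotted ev) _ rewrite eu | ev = refl
  edge-class {u} {v} (slotted {i} eu) (outside _ refl) _
    rewrite Vecₚ.lookup∘tabulate (λ j → edgeTo v (slot j)) i | eu = Graph.sym G u v
  edge-class {u} (outside _ refl) (slotted {j} ev) _
    rewrite Vecₚ.lookup∘tabulate (λ i → edgeTo u (slot i)) j | ev = refl
  edge-class (outside u∉ _) (outside v∉ _) u≢v =
    ¬-not (λ e → [ u∉ , v∉ ] (covers u≢v e))

  same-class : ∀ {u v a} → ClassOf u a → ClassOf v a → u ≢ v → E G u v ≡ false
  same-class (slotted eu) (slotted ev) u≢v =
    contradiction (Maybeₚ.just-injective (trans (sym eu) ev)) u≢v
  same-class cu@(outside _ _) cv@(outside _ _) u≢v = edge-class cu cv u≢v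

  coverPresentation : Presentation (Class K) G
  coverPresentation = record
    { class             = λ u → proj₁ (classify u)
    ; adjacency         = classAdjacency
    ; edge-class        = λ {u} {v} → edge-class (proj₂ (classify u)) (proj₂ (classify v))
    ; class-independent = λ {u} {v} u≢v same →
        same-class (proj₂ (classify u)) (subst (ClassOf v) (sym same) (proj₂ (classify v))) u≢v
    }

PresentedGraph : Set → Set
PresentedGraph Cl = Σ Graph (Presentation Cl)

module Domination {Cl : Set} (_≟_ : DecidableEquality Cl) where
  open Fibres _≟_
  open Presentation

  SameLoops SameAdjacency SmallerClasses _≤ᵖ_ : Rel (PresentedGraph Cl) 0ℓ
  SameLoops      (A , _)  (B , _)  = loopBit A ≡ loopBit B
  SameAdjacency  (_ , pA) (_ , pB) = ∀ a b → adjacency pA a b ≡ adjacency pB a b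
  SmallerClasses (_ , pA) (_ , pB) = ∀ cl → count (class pA) cl ⊑ count (class pB) cl
  x ≤ᵖ y = SameLoops x y × SameAdjacency x y × SmallerClasses x y

  ≤ᵖ⇒≼ₛ : ∀ {x y} → x ≤ᵖ y → proj₁ x ≼ₛ proj₁ y
  ≤ᵖ⇒≼ₛ {_ , pA} {_ , pB} (loops≡ , adjacency≡ , counts⊑)
    with class-surjection (class pA) (class pB) counts⊑
  ... | f , f-class , f-surj =
    f , class-preserving⇒strongEpi pA pB loops≡ adjacency≡ f f-class f-surj

  af-≤ᵖ : Finitary Cl → AlmostFull _≤ᵖ_
  af-≤ᵖ finitary =
    af-∩ {R = SameLoops} (af-comap (loopBit ∘ proj₁) af-≡-Bool)
   (af-∩ {R = SameAdjacency} {S = SmallerClasses}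
     (finitary _ λ a → finitary _ λ b → af-comap (λ x → adjacency (proj₂ x) a b) af-≡-Bool)
     (finitary _ λ cl → af-comap (λ x → count (class (proj₂ x)) cl) af-⊑))

finitary-Class : ∀ K → Finitary (Class K)
finitary-Class K = finitary-⊎ (finitary-Fin K) (finitary-Vec finitary-Bool K)

-- Strong homomorphic images are almost full on graphs whose matchings have at
-- most N edges: present each over the classes of a cover by N + N slots.
strongEpi-almostFull : ∀ N → AlmostFull {Σ Graph (MatchingBounded N)} (λ x y → proj₁ x ≼ₛ proj₁ y)
strongEpi-almostFull N =
  af-mono (λ {x} {y} → ≤ᵖ⇒≼ₛ {present x} {present y})
          (af-comap present (af-≤ᵖ (finitary-Class (N + N))))
  where
  open Domination _≟ᶜ_
  present : Σ Graph (MatchingBounded N) → PresentedGraph (Class (N + N))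
  present (G , bounded) = G , coverPresentation (matchingBounded⇒cover G bounded)

corollary2p4 : (C : Graph → Set) →
    Σ ℕ (λ N → ∀ G → C G → MatchingBounded N G) →
    WellQuasiOrdered C _≼_ × WellQuasiOrdered C _≼ₛ_
corollary2p4 C (N , bounded) =
  almostFull⇒wqo (λ {A} {B} {D} → ≼-trans {A} {B} {D})
                 (af-mono (λ {x} {y} → ≼ₛ⇒≼ {proj₁ x} {proj₁ y}) strong) ,
  almostFull⇒wqo (λ {A} {B} {D} → ≼ₛ-trans {A} {B} {D}) strong
  where
  strong : AlmostFull {Σ Graph C} (λ x y → proj₁ x ≼ₛ proj₁ y)
  strong = af-comap (λ (G , cG) → G , bounded G cG) (strongEpi-almostFull N)
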